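{- Regard each element $f\in\Gamma$ as the function $\lambda\mapsto f(\lambda)$ on the set of strict partitions. Then $\Gamma$ coincides with the algebra of functions on strict partitions generated by the function $\lambda\mapsto|\lambda|$ together with all functions $\widehat F:\lambda\mapsto F(\widehat c_\square:\square\in S(\lambda))$, where $F$ ranges over (ordinary) symmetric functions.
   Context: A strict partition is a strictly decreasing finite sequence $\lambda=(\lambda_1,\dots,\lambda_l)$ of positive integers (including $\emptyset$), $\ell(\lambda)=l$, $|\lambda|=\sum_i\lambda_i$. Shifted diagram $S(\lambda)=\{(i,j)\in\mathbb{Z}^2:1\le i\le\ell(\lambda),\ i\le j\le\lambda_i+i-1\}$; content $c_\square=j-i$; $\widehat c_\square=\tfrac12c_\square(c_\square+1)$. $F(\widehat c_\square:\square\in S(\lambda))$ is the specialization of the symmetric function $F(x_1,x_2,\dots)$ (rational coefficients) setting the first $|\lambda|$ variables to the numbers $\widehat c_\square$, $\square\in S(\lambda)$, and the remaining variables to $0$. $p_r=x_1^r+x_2^r+\cdots$; $\Gamma$ is the $\mathbb{Q}$-subalgebra of symmetric functions generated by $p_1,p_3,p_5,\dots$; for $f\in\Gamma$, $f(\lambda)=f(\lambda_1,\dots,\lambda_{\ell(\lambda)},0,\dots)$; distinct elements of $\Gamma$ give distinct functions on strict partitions. -}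

module Defs where

open import Data.Nat as ℕ using (ℕ; zero; suc; NonZero; _∸_; _<_; _>_)
open import Data.Integer using (+_)
open import Data.Rational using (ℚ; _/_; 0ℚ; 1ℚ; _+_; _*_)
open import Data.List using (List; []; _∷_; map; foldr; length; _++_; upTo)
open import Data.List.Relation.Unary.All using (All)
open import Data.List.Relation.Unary.Linked using (Linked)
open import Data.Product using (_×_; _,_)

ℕtoℚ : ℕ → ℚ
ℕtoℚ n = (+ n) / 1

_^ℚ_ : ℚ → ℕ → ℚ
x ^ℚ zero = 1ℚ
x ^ℚ suc n = x * (x ^ℚ n)

sumℚ : List ℚ → ℚ
sumℚ = foldr _+_ 0ℚ

IsStrictPartition : List ℕ → Set
IsStrictPartition λs = All (λ x → 0 < x) λs × Linked _>_ λs

size : List ℕ → ℕ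
size = foldr ℕ._+_ 0

-- Shifted diagram S(λ) = {(i,j) : 1 ≤ i ≤ ℓ(λ), i ≤ j ≤ λ_i + i - 1},
-- listed row by row (rows indexed from 1).
row : ℕ → ℕ → List (ℕ × ℕ)
row i l = map (λ k → (i , i ℕ.+ k)) (upTo l)

shiftedFrom : ℕ → List ℕ → List (ℕ × ℕ)
shiftedFrom i [] = []
shiftedFrom i (l ∷ ls) = row i l ++ shiftedFrom (suc i) ls

shiftedDiagram : List ℕ → List (ℕ × ℕ)
shiftedDiagram = shiftedFrom 1

-- content c = j - i (nonnegative on the shifted diagram since j ≥ i)
content : ℕ × ℕ → ℕ
content (i , j) = j ∸ i

chat : ℕ × ℕ → ℚ
chat b = (+ (content b ℕ.* suc (content b))) / 2

-- Symmetric functions over ℚ, presented as ℚ-polynomial expressions in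
-- the power sums p_r (r ≥ 1), which generate Λ_ℚ as a ℚ-algebra.

data SymFn : Set where
  const : ℚ → SymFn
  p     : (r : ℕ) → .{{NonZero r}} → SymFn
  add   : SymFn → SymFn → SymFn
  mul   : SymFn → SymFn → SymFn

-- Specialization F(x₁,…,x_n,0,0,…) at a finite list of values.
-- (Power sums p_r with r ≥ 1 vanish on the zero variables.)
evalSym : SymFn → List ℚ → ℚ
evalSym (const q) xs = q
evalSym (p r) xs = sumℚ (map (λ x → x ^ℚ r) xs)
evalSym (add F G) xs = evalSym F xs + evalSym G xs
evalSym (mul F G) xs = evalSym F xs * evalSym G xs

data InΓ : SymFn → Set where
  const : (q : ℚ) → InΓ (const q)
  podd  : (k : ℕ) → InΓ (p (suc (2 ℕ.* k)))
  add   : ∀ {F G} → InΓ F → InΓ G → InΓ (add F G)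
  mul   : ∀ {F G} → InΓ F → InΓ G → InΓ (mul F G)

evalAtPartition : SymFn → List ℕ → ℚ
evalAtPartition f λs = evalSym f (map ℕtoℚ λs)

hatEval : SymFn → List ℕ → ℚ
hatEval F λs = evalSym F (map chat (shiftedDiagram λs))

-- The algebra of functions on strict partitions generated by λ ↦ |λ| and
-- all F̂: elements are ℚ-polynomial expressions in these generators.

data GenExpr : Set where
  const : ℚ → GenExpr
  sizeG : GenExpr
  hat   : SymFn → GenExpr
  add   : GenExpr → GenExpr → GenExpr
  mul   : GenExpr → GenExpr → GenExpr

evalGen : GenExpr → List ℕ → ℚ
evalGen (const q) λs = q
evalGen sizeG λs = ℕtoℚ (size λs)
evalGen (hat F) λs = hatEval F λs
evalGen (add e e') λs = evalGen e λs + evalGen e' λs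
evalGen (mul e e') λs = evalGen e λs * evalGen e' λs

-- Row i of S(λ) has contents 0, …, λᵢ − 1, so F̂(λ) is a sum over rows of Σ_{k<λᵢ} g(k(k+1)/2).
-- With D_m(k) = ∏_{i<m} (k(k+1) − i(i+1)) and the central factorial E_m(l) = l ∏_{i=1}^m (l² − i²),
-- one has E_m(l+1) − E_m(l) = (2m+1) D_m(l), so Σ_{k<l} D_m(k) = E_m(l)/(2m+1) is an odd polynomial in l.
-- Expanding (k(k+1))^r in the Newton basis (D_m(k))_m therefore gives p̂_r ∈ Γ. Conversely l^{2k+1} is a
-- combination of the E_m(l) (Newton basis in l² with nodes j²); Σᵢ E_0(λᵢ) = |λ|, and for m ≥ 1 the row
-- sums of D_m, a polynomial in ĉ without constant term, give Σᵢ E_m(λᵢ) as (2m+1) F̂(λ) for some F.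
module Submission where

open import Defs
open import Data.List using (List)
open import Data.Nat using (ℕ)
open import Data.Product using (Σ; _×_)
open import Relation.Binary.PropositionalEquality using (_≡_)

open import Data.Nat as ℕ using (zero; suc)
import Data.Nat.Properties as ℕP
import Data.Integer as ℤ
import Data.Integer.Properties as ℤP
import Data.Integer.Solver as ℤSolver
open import Data.Rational using (ℚ; _/_; 0ℚ; 1ℚ; _+_; _*_; _-_; -_; ½; fromℚᵘ)
open import Data.Rational.Properties
  using (toℚᵘ-injective; toℚᵘ-fromℚᵘ; toℚᵘ-homo-+; toℚᵘ-homo-*; fromℚᵘ-cong;
         +-identityˡ; +-identityʳ; +-assoc; *-comm; *-zeroˡ; *-zeroʳ; *-identityˡ; *-identityʳ; *-assoc; *-distribˡ-+)
import Data.Rational.Unnormalised as ℚᵘ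
import Data.Rational.Unnormalised.Properties as ℚᵘP
open import Data.Rational.Solver using (module +-*-Solver)
open import Data.List using ([]; _∷_; map; _++_; upTo; [_])
open import Data.List.Properties using (map-++; map-∘; upTo-∷ʳ)
open import Data.Product using (_,_)
open import Relation.Binary.PropositionalEquality using (refl; sym; trans; cong; cong₂; module ≡-Reasoning)

open ≡-Reasoning

-- ι n, ½ and recipSuc k are definitionally fromℚᵘ of unnormalised fractions, so identities between them
-- reduce to fromℚᵘ being a homomorphism and an identity of integers.
fromℚᵘ-homo-+ : ∀ x y → fromℚᵘ (x ℚᵘ.+ y) ≡ fromℚᵘ x + fromℚᵘ y
fromℚᵘ-homo-+ x y = toℚᵘ-injective (ℚᵘP.≃-trans (toℚᵘ-fromℚᵘ (x ℚᵘ.+ y))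
  (ℚᵘP.≃-sym (ℚᵘP.≃-trans (toℚᵘ-homo-+ (fromℚᵘ x) (fromℚᵘ y))
                          (ℚᵘP.+-cong (toℚᵘ-fromℚᵘ x) (toℚᵘ-fromℚᵘ y)))))

fromℚᵘ-homo-* : ∀ x y → fromℚᵘ (x ℚᵘ.* y) ≡ fromℚᵘ x * fromℚᵘ y
fromℚᵘ-homo-* x y = toℚᵘ-injective (ℚᵘP.≃-trans (toℚᵘ-fromℚᵘ (x ℚᵘ.* y))
  (ℚᵘP.≃-sym (ℚᵘP.≃-trans (toℚᵘ-homo-* (fromℚᵘ x) (fromℚᵘ y))
                          (ℚᵘP.*-cong (toℚᵘ-fromℚᵘ x) (toℚᵘ-fromℚᵘ y)))))

ι : ℕ → ℚ
ι = ℕtoℚ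

ℕ→ℚᵘ : ℕ → ℚᵘ.ℚᵘ
ℕ→ℚᵘ n = ℚᵘ.mkℚᵘ (ℤ.+ n) 0

recipSuc : ℕ → ℚ
recipSuc k = ℤ.+ 1 / suc k

module _ where
  open ℤSolver.+-*-Solver

  ι-+ : ∀ m n → ι (m ℕ.+ n) ≡ ι m + ι n
  ι-+ m n = trans (fromℚᵘ-cong {ℕ→ℚᵘ (m ℕ.+ n)} {ℕ→ℚᵘ m ℚᵘ.+ ℕ→ℚᵘ n} (ℚᵘ.*≡* eq)) (fromℚᵘ-homo-+ (ℕ→ℚᵘ m) (ℕ→ℚᵘ n))
    where
    eq = trans (cong (ℤ._* ℤ.+ 1) (ℤP.pos-+ m n))
      (solve 2 (λ a b → (a :+ b) :* con (ℤ.+ 1) := (a :* con (ℤ.+ 1) :+ b :* con (ℤ.+ 1)) :* con (ℤ.+ 1)) refl (ℤ.+ m) (ℤ.+ n))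

  ι-* : ∀ m n → ι (m ℕ.* n) ≡ ι m * ι n
  ι-* m n = trans (fromℚᵘ-cong {ℕ→ℚᵘ (m ℕ.* n)} {ℕ→ℚᵘ m ℚᵘ.* ℕ→ℚᵘ n} (ℚᵘ.*≡* eq)) (fromℚᵘ-homo-* (ℕ→ℚᵘ m) (ℕ→ℚᵘ n))
    where
    eq = trans (cong (ℤ._* ℤ.+ 1) (ℤP.pos-* m n))
      (solve 2 (λ a b → (a :* b) :* con (ℤ.+ 1) := (a :* b) :* con (ℤ.+ 1)) refl (ℤ.+ m) (ℤ.+ n))

  m/2≡½*m : ∀ m → ℤ.+ m / 2 ≡ ½ * ι m
  m/2≡½*m m = trans (fromℚᵘ-cong {ℚᵘ.mkℚᵘ (ℤ.+ m) 1} {ℚᵘ.mkℚᵘ (ℤ.+ 1) 1 ℚᵘ.* ℕ→ℚᵘ m} (ℚᵘ.*≡* eq))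
                    (fromℚᵘ-homo-* (ℚᵘ.mkℚᵘ (ℤ.+ 1) 1) (ℕ→ℚᵘ m))
    where
    eq = solve 1 (λ a → a :* con (ℤ.+ 2) := (con (ℤ.+ 1) :* a) :* con (ℤ.+ 2)) refl (ℤ.+ m)

  recipSuc-inverse : ∀ k → recipSuc k * ι (suc k) ≡ 1ℚ
  recipSuc-inverse k = trans (sym (fromℚᵘ-homo-* (ℚᵘ.mkℚᵘ (ℤ.+ 1) k) (ℕ→ℚᵘ (suc k))))
                             (fromℚᵘ-cong {ℚᵘ.mkℚᵘ (ℤ.+ 1) k ℚᵘ.* ℕ→ℚᵘ (suc k)} {ℕ→ℚᵘ 1} (ℚᵘ.*≡* eq))
    where
    eq : (ℤ.+ 1 ℤ.* ℤ.+ suc k) ℤ.* ℤ.+ 1 ≡ ℤ.+ 1 ℤ.* (ℤ.+ suc k ℤ.* ℤ.+ 1)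
    eq = solve 1 (λ a → (con (ℤ.+ 1) :* a) :* con (ℤ.+ 1) := con (ℤ.+ 1) :* (a :* con (ℤ.+ 1))) refl (ℤ.+ suc k)

ι-suc : ∀ n → ι (suc n) ≡ 1ℚ + ι n
ι-suc = ι-+ 1

open +-*-Solver

sum-++ : ∀ xs ys → sumℚ (xs ++ ys) ≡ sumℚ xs + sumℚ ys
sum-++ [] ys = sym (+-identityˡ (sumℚ ys))
sum-++ (x ∷ xs) ys = trans (cong (x +_) (sum-++ xs ys)) (sym (+-assoc x (sumℚ xs) (sumℚ ys)))

module _ {A : Set} where

  sum-cong : ∀ {f g : A → ℚ} xs → (∀ x → f x ≡ g x) → sumℚ (map f xs) ≡ sumℚ (map g xs)
  sum-cong [] f≡g = refl
  sum-cong (x ∷ xs) f≡g = cong₂ _+_ (f≡g x) (sum-cong xs f≡g)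

  sum-zero : ∀ (xs : List A) → sumℚ (map (λ _ → 0ℚ) xs) ≡ 0ℚ
  sum-zero [] = refl
  sum-zero (x ∷ xs) = trans (+-identityˡ _) (sum-zero xs)

  sum-+ : ∀ (f g : A → ℚ) xs → sumℚ (map (λ x → f x + g x) xs) ≡ sumℚ (map f xs) + sumℚ (map g xs)
  sum-+ f g [] = refl
  sum-+ f g (x ∷ xs) = trans (cong (f x + g x +_) (sum-+ f g xs))
    (solve 4 (λ a b c d → (a :+ b) :+ (c :+ d) := (a :+ c) :+ (b :+ d)) refl (f x) (g x) _ _)

  sum-* : ∀ z (f : A → ℚ) xs → sumℚ (map (λ x → z * f x) xs) ≡ z * sumℚ (map f xs)
  sum-* z f [] = sym (*-zeroʳ z)
  sum-* z f (x ∷ xs) = trans (cong (z * f x +_) (sum-* z f xs)) (sym (*-distribˡ-+ z _ _))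

sum-map-map : ∀ {A B : Set} (g : B → ℚ) (f : A → B) xs → sumℚ (map g (map f xs)) ≡ sumℚ (map (λ x → g (f x)) xs)
sum-map-map g f xs = cong sumℚ (sym (map-∘ xs))

sum-upTo-suc : ∀ (f : ℕ → ℚ) n → sumℚ (map f (upTo (suc n))) ≡ sumℚ (map f (upTo n)) + f n
sum-upTo-suc f n = begin
  sumℚ (map f (upTo (suc n)))            ≡⟨ cong (λ ks → sumℚ (map f ks)) (sym (upTo-∷ʳ n)) ⟩
  sumℚ (map f (upTo n ++ [ n ]))         ≡⟨ cong sumℚ (map-++ f (upTo n) [ n ]) ⟩
  sumℚ (map f (upTo n) ++ [ f n ])       ≡⟨ sum-++ (map f (upTo n)) [ f n ] ⟩
  sumℚ (map f (upTo n)) + (f n + 0ℚ)     ≡⟨ cong (sumℚ (map f (upTo n)) +_) (+-identityʳ (f n)) ⟩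
  sumℚ (map f (upTo n)) + f n            ∎

sum-telescope : ∀ (f F : ℕ → ℚ) → F 0 ≡ 0ℚ → (∀ n → F (suc n) ≡ F n + f n) →
                ∀ n → sumℚ (map f (upTo n)) ≡ F n
sum-telescope f F F0≡0 F-step zero = sym F0≡0
sum-telescope f F F0≡0 F-step (suc n) = begin
  sumℚ (map f (upTo (suc n)))  ≡⟨ sum-upTo-suc f n ⟩
  sumℚ (map f (upTo n)) + f n  ≡⟨ cong (_+ f n) (sum-telescope f F F0≡0 F-step n) ⟩
  F n + f n                    ≡⟨ sym (F-step n) ⟩
  F (suc n)                    ∎

^ℚ-distrib-* : ∀ x y r → (x * y) ^ℚ r ≡ x ^ℚ r * y ^ℚ r
^ℚ-distrib-* x y zero = refl
^ℚ-distrib-* x y (suc r) = trans (cong ((x * y) *_) (^ℚ-distrib-* x y r))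
  (solve 4 (λ x y a b → (x :* y) :* (a :* b) := (x :* a) :* (y :* b)) refl x y (x ^ℚ r) (y ^ℚ r))

^ℚ-odd : ∀ x k → x ^ℚ suc (2 ℕ.* k) ≡ x * (x * x) ^ℚ k
^ℚ-odd x zero = refl
^ℚ-odd x (suc k) rewrite ℕP.+-suc k (k ℕ.+ 0) =
  trans (cong (λ t → x * (x * t)) (^ℚ-odd x k))
    (solve 2 (λ x t → x :* (x :* (x :* t)) := x :* ((x :* x) :* t)) refl x ((x * x) ^ℚ k))

-- Polynomials as coefficient lists, lowest degree first

Poly : Set
Poly = List ℚ

horner : Poly → ℚ → ℚ
horner [] y = 0ℚ
horner (c ∷ cs) y = c + y * horner cs y

addPoly : Poly → Poly → Poly
addPoly [] bs = bs
addPoly (a ∷ as) [] = a ∷ as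
addPoly (a ∷ as) (b ∷ bs) = (a + b) ∷ addPoly as bs

scalePoly : ℚ → Poly → Poly
scalePoly a = map (a *_)

mulLinear : ℚ → ℚ → Poly → Poly
mulLinear a b cs = addPoly (0ℚ ∷ scalePoly a cs) (scalePoly (- b) cs)

horner-addPoly : ∀ as bs y → horner (addPoly as bs) y ≡ horner as y + horner bs y
horner-addPoly [] bs y = sym (+-identityˡ _)
horner-addPoly (a ∷ as) [] y = sym (+-identityʳ _)
horner-addPoly (a ∷ as) (b ∷ bs) y = trans (cong (λ t → a + b + y * t) (horner-addPoly as bs y))
  (solve 5 (λ a b y p q → a :+ b :+ y :* (p :+ q) := (a :+ y :* p) :+ (b :+ y :* q))
     refl a b y (horner as y) (horner bs y))

horner-scalePoly : ∀ a cs y → horner (scalePoly a cs) y ≡ a * horner cs y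
horner-scalePoly a [] y = sym (*-zeroʳ a)
horner-scalePoly a (c ∷ cs) y = trans (cong (λ t → a * c + y * t) (horner-scalePoly a cs y))
  (solve 4 (λ a c y p → a :* c :+ y :* (a :* p) := a :* (c :+ y :* p)) refl a c y (horner cs y))

horner-mulLinear : ∀ a b cs y → horner (mulLinear a b cs) y ≡ (a * y - b) * horner cs y
horner-mulLinear a b cs y = begin
  horner (mulLinear a b cs) y
    ≡⟨ horner-addPoly (0ℚ ∷ scalePoly a cs) (scalePoly (- b) cs) y ⟩
  0ℚ + y * horner (scalePoly a cs) y + horner (scalePoly (- b) cs) y
    ≡⟨ cong₂ (λ s t → 0ℚ + y * s + t) (horner-scalePoly a cs y) (horner-scalePoly (- b) cs y) ⟩
  0ℚ + y * (a * horner cs y) + (- b) * horner cs y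
    ≡⟨ solve 4 (λ a b y p → con 0ℚ :+ y :* (a :* p) :+ (:- b) :* p := (a :* y :- b) :* p) refl a b y (horner cs y) ⟩
  (a * y - b) * horner cs y ∎

combination : (ℕ → ℚ) → ℕ → List ℚ → ℚ
combination B s [] = 0ℚ
combination B s (a ∷ as) = a * B s + combination B (suc s) as

combination-cong : ∀ {B C : ℕ → ℚ} → (∀ i → B i ≡ C i) → ∀ s as → combination B s as ≡ combination C s as
combination-cong B≡C s [] = refl
combination-cong B≡C s (a ∷ as) = cong₂ (λ b c → a * b + c) (B≡C s) (combination-cong B≡C (suc s) as)

combination-*ˡ : ∀ z (B : ℕ → ℚ) s as → combination (λ i → z * B i) s as ≡ z * combination B s as
combination-*ˡ z B s [] = sym (*-zeroʳ z)
combination-*ˡ z B s (a ∷ as) = trans (cong (a * (z * B s) +_) (combination-*ˡ z B (suc s) as))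
  (solve 4 (λ z a b c → a :* (z :* b) :+ z :* c := z :* (a :* b :+ c)) refl z a (B s) (combination B (suc s) as))

sum-combination : ∀ {A : Set} (f : ℕ → A → ℚ) xs s as →
  sumℚ (map (λ x → combination (λ i → f i x) s as) xs) ≡ combination (λ i → sumℚ (map (f i) xs)) s as
sum-combination f xs s [] = sum-zero xs
sum-combination f xs s (a ∷ as) = begin
  sumℚ (map (λ x → a * f s x + combination (λ i → f i x) (suc s) as) xs)
    ≡⟨ sum-+ (λ x → a * f s x) (λ x → combination (λ i → f i x) (suc s) as) xs ⟩
  sumℚ (map (λ x → a * f s x) xs) + sumℚ (map (λ x → combination (λ i → f i x) (suc s) as) xs)
    ≡⟨ cong₂ _+_ (sum-* a (f s) xs) (sum-combination f xs (suc s) as) ⟩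
  a * sumℚ (map (f s) xs) + combination (λ i → sumℚ (map (f i) xs)) (suc s) as ∎

combination-powers : ∀ y s cs → combination (λ i → y ^ℚ i) s cs ≡ y ^ℚ s * horner cs y
combination-powers y s [] = sym (*-zeroʳ (y ^ℚ s))
combination-powers y s (c ∷ cs) = trans (cong (c * y ^ℚ s +_) (combination-powers y (suc s) cs))
  (solve 4 (λ c v y h → c :* v :+ (y :* v) :* h := v :* (c :+ y :* h)) refl c (y ^ℚ s) y (horner cs y))

addToHead : ℚ → List ℚ → List ℚ
addToHead a [] = a ∷ []
addToHead a (b ∷ bs) = (a + b) ∷ bs

combination-addToHead : ∀ B s a as → combination B s (addToHead a as) ≡ a * B s + combination B s as
combination-addToHead B s a [] = refl
combination-addToHead B s a (b ∷ bs) =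
  solve 4 (λ a b x y → (a :+ b) :* x :+ y := a :* x :+ (b :* x :+ y)) refl a b (B s) (combination B (suc s) bs)

NewtonBasis : (ℕ → ℚ) → (ℕ → ℚ) → ℚ → Set
NewtonBasis B ν w = ∀ s → B (suc s) ≡ B s * (w - ν s)

-- Multiplication by w in a Newton basis: a·w·Bₛ = (a·νₛ)·Bₛ + a·Bₛ₊₁.
newtonStep : (ℕ → ℚ) → ℕ → List ℚ → List ℚ
newtonStep ν s [] = []
newtonStep ν s (a ∷ as) = (a * ν s) ∷ addToHead a (newtonStep ν (suc s) as)

combination-newtonStep : ∀ {B ν w} → NewtonBasis B ν w →
  ∀ s as → w * combination B s as ≡ combination B s (newtonStep ν s as)
combination-newtonStep {w = w} basis s [] = *-zeroʳ w
combination-newtonStep {B} {ν} {w} basis s (a ∷ as) = begin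
  w * (a * B s + combination B (suc s) as)
    ≡⟨ *-distribˡ-+ w _ _ ⟩
  w * (a * B s) + w * combination B (suc s) as
    ≡⟨ cong (w * (a * B s) +_) (combination-newtonStep {B} {ν} {w} basis (suc s) as) ⟩
  w * (a * B s) + rest
    ≡⟨ solve 5 (λ w a b v r → w :* (a :* b) :+ r := (a :* v) :* b :+ (a :* (b :* (w :- v)) :+ r)) refl w a (B s) (ν s) rest ⟩
  (a * ν s) * B s + (a * (B s * (w - ν s)) + rest)
    ≡⟨ cong (λ t → (a * ν s) * B s + (a * t + rest)) (sym (basis s)) ⟩
  (a * ν s) * B s + (a * B (suc s) + rest)
    ≡⟨ cong ((a * ν s) * B s +_) (sym (combination-addToHead B (suc s) a (newtonStep ν (suc s) as))) ⟩
  (a * ν s) * B s + combination B (suc s) (addToHead a (newtonStep ν (suc s) as)) ∎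
  where rest = combination B (suc s) (newtonStep ν (suc s) as)

newtonPower : (ℕ → ℚ) → ℕ → List ℚ
newtonPower ν zero = 1ℚ ∷ []
newtonPower ν (suc r) = newtonStep ν 0 (newtonPower ν r)

newtonExpansion : ∀ {B ν w} → NewtonBasis B ν w → ∀ r → w ^ℚ r * B 0 ≡ combination B 0 (newtonPower ν r)
newtonExpansion {B} basis zero = solve 1 (λ b → con 1ℚ :* b := con 1ℚ :* b :+ con 0ℚ) refl (B 0)
newtonExpansion {B} {ν} {w} basis (suc r) = begin
  (w * w ^ℚ r) * B 0                  ≡⟨ *-assoc w (w ^ℚ r) (B 0) ⟩
  w * (w ^ℚ r * B 0)                  ≡⟨ cong (w *_) (newtonExpansion basis r) ⟩
  w * combination B 0 (newtonPower ν r) ≡⟨ combination-newtonStep {B} {ν} {w} basis 0 (newtonPower ν r) ⟩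
  combination B 0 (newtonPower ν (suc r)) ∎

pronic : ℚ → ℚ
pronic x = x * (1ℚ + x)

-- Since pronic x - pronic i = (x - i)(x + 1 + i), pronicProduct m and centralFactorial m are the falling
-- factorials of lengths 2m and 2m + 1 starting at x + m; hence the difference lemma below.
pronicProduct : ℕ → ℚ → ℚ
pronicProduct zero x = 1ℚ
pronicProduct (suc m) x = pronicProduct m x * (pronic x - pronic (ι m))

centralFactorial : ℕ → ℚ → ℚ
centralFactorial zero x = x
centralFactorial (suc m) x = centralFactorial m x * (x * x - ι (suc m) * ι (suc m))

centralFactorial-shift : ∀ m x → centralFactorial m (1ℚ + x) ≡ (1ℚ + x + ι m) * pronicProduct m x
centralFactorial-shift zero x = solve 1 (λ x → con 1ℚ :+ x := (con 1ℚ :+ x :+ con 0ℚ) :* con 1ℚ) refl x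
centralFactorial-shift (suc m) x = begin
  centralFactorial m (1ℚ + x) * ((1ℚ + x) * (1ℚ + x) - ι (suc m) * ι (suc m))
    ≡⟨ cong₂ (λ a b → a * ((1ℚ + x) * (1ℚ + x) - b * b)) (centralFactorial-shift m x) (ι-suc m) ⟩
  (1ℚ + x + ι m) * pronicProduct m x * ((1ℚ + x) * (1ℚ + x) - (1ℚ + ι m) * (1ℚ + ι m))
    ≡⟨ solve 3 (λ x m d → (con 1ℚ :+ x :+ m) :* d :* ((con 1ℚ :+ x) :* (con 1ℚ :+ x) :- (con 1ℚ :+ m) :* (con 1ℚ :+ m))
                        := (con 1ℚ :+ x :+ (con 1ℚ :+ m)) :* (d :* (x :* (con 1ℚ :+ x) :- m :* (con 1ℚ :+ m))))
         refl x (ι m) (pronicProduct m x) ⟩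
  (1ℚ + x + (1ℚ + ι m)) * pronicProduct (suc m) x
    ≡⟨ cong (λ b → (1ℚ + x + b) * pronicProduct (suc m) x) (sym (ι-suc m)) ⟩
  (1ℚ + x + ι (suc m)) * pronicProduct (suc m) x ∎

centralFactorial≡pronicProduct* : ∀ m x → centralFactorial m x ≡ pronicProduct m x * (x - ι m)
centralFactorial≡pronicProduct* zero x = solve 1 (λ x → x := con 1ℚ :* (x :- con 0ℚ)) refl x
centralFactorial≡pronicProduct* (suc m) x = begin
  centralFactorial m x * (x * x - ι (suc m) * ι (suc m))
    ≡⟨ cong₂ (λ a b → a * (x * x - b * b)) (centralFactorial≡pronicProduct* m x) (ι-suc m) ⟩
  pronicProduct m x * (x - ι m) * (x * x - (1ℚ + ι m) * (1ℚ + ι m))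
    ≡⟨ solve 3 (λ x m d → d :* (x :- m) :* (x :* x :- (con 1ℚ :+ m) :* (con 1ℚ :+ m))
                        := d :* (x :* (con 1ℚ :+ x) :- m :* (con 1ℚ :+ m)) :* (x :- (con 1ℚ :+ m)))
         refl x (ι m) (pronicProduct m x) ⟩
  pronicProduct (suc m) x * (x - (1ℚ + ι m))
    ≡⟨ cong (λ b → pronicProduct (suc m) x * (x - b)) (sym (ι-suc m)) ⟩
  pronicProduct (suc m) x * (x - ι (suc m)) ∎

centralFactorial-difference : ∀ m x →
  centralFactorial m (1ℚ + x) ≡ centralFactorial m x + ι (suc (2 ℕ.* m)) * pronicProduct m x
centralFactorial-difference m x = begin
  centralFactorial m (1ℚ + x)
    ≡⟨ centralFactorial-shift m x ⟩
  (1ℚ + x + ι m) * pronicProduct m x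
    ≡⟨ solve 3 (λ x m d → (con 1ℚ :+ x :+ m) :* d := d :* (x :- m) :+ (con 1ℚ :+ (m :+ (m :+ con 0ℚ))) :* d)
         refl x (ι m) (pronicProduct m x) ⟩
  pronicProduct m x * (x - ι m) + (1ℚ + (ι m + (ι m + 0ℚ))) * pronicProduct m x
    ≡⟨ cong₂ (λ a b → a + b * pronicProduct m x) (sym (centralFactorial≡pronicProduct* m x)) (sym ι-odd) ⟩
  centralFactorial m x + ι (suc (2 ℕ.* m)) * pronicProduct m x ∎
  where
  ι-odd : ι (suc (2 ℕ.* m)) ≡ 1ℚ + (ι m + (ι m + 0ℚ))
  ι-odd = trans (ι-suc (2 ℕ.* m)) (cong (1ℚ +_) (trans (ι-+ m (m ℕ.+ 0)) (cong (ι m +_) (ι-+ m 0))))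

centralFactorial-zero : ∀ m → centralFactorial m 0ℚ ≡ 0ℚ
centralFactorial-zero zero = refl
centralFactorial-zero (suc m) = trans (cong (_* (0ℚ * 0ℚ - ι (suc m) * ι (suc m))) (centralFactorial-zero m))
  (*-zeroˡ (0ℚ * 0ℚ - ι (suc m) * ι (suc m)))

sum-pronicProduct : ∀ m n →
  sumℚ (map (λ k → pronicProduct m (ι k)) (upTo n)) ≡ recipSuc (2 ℕ.* m) * centralFactorial m (ι n)
sum-pronicProduct m = sum-telescope (λ k → pronicProduct m (ι k)) (λ n → c * centralFactorial m (ι n))
  (trans (cong (c *_) (centralFactorial-zero m)) (*-zeroʳ c)) step
  where
  c = recipSuc (2 ℕ.* m)
  step : ∀ n → c * centralFactorial m (ι (suc n)) ≡ c * centralFactorial m (ι n) + pronicProduct m (ι n)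
  step n = begin
    c * centralFactorial m (ι (suc n))
      ≡⟨ cong (λ t → c * centralFactorial m t) (ι-suc n) ⟩
    c * centralFactorial m (1ℚ + ι n)
      ≡⟨ cong (c *_) (centralFactorial-difference m (ι n)) ⟩
    c * (centralFactorial m (ι n) + ι (suc (2 ℕ.* m)) * pronicProduct m (ι n))
      ≡⟨ solve 4 (λ c e i d → c :* (e :+ i :* d) := c :* e :+ (c :* i) :* d)
           refl c (centralFactorial m (ι n)) (ι (suc (2 ℕ.* m))) (pronicProduct m (ι n)) ⟩
    c * centralFactorial m (ι n) + (c * ι (suc (2 ℕ.* m))) * pronicProduct m (ι n)
      ≡⟨ cong (λ t → c * centralFactorial m (ι n) + t * pronicProduct m (ι n)) (recipSuc-inverse (2 ℕ.* m)) ⟩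
    c * centralFactorial m (ι n) + 1ℚ * pronicProduct m (ι n)
      ≡⟨ cong (c * centralFactorial m (ι n) +_) (*-identityˡ (pronicProduct m (ι n))) ⟩
    c * centralFactorial m (ι n) + pronicProduct m (ι n) ∎

centralFactorialPoly : ℕ → Poly
centralFactorialPoly zero = 1ℚ ∷ []
centralFactorialPoly (suc m) = mulLinear 1ℚ (ι (suc m) * ι (suc m)) (centralFactorialPoly m)

centralFactorial-horner : ∀ m x → centralFactorial m x ≡ x * horner (centralFactorialPoly m) (x * x)
centralFactorial-horner zero x = solve 1 (λ x → x := x :* (con 1ℚ :+ x :* x :* con 0ℚ)) refl x
centralFactorial-horner (suc m) x = begin
  centralFactorial m x * (x * x - c)
    ≡⟨ cong (_* (x * x - c)) (centralFactorial-horner m x) ⟩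
  x * h * (x * x - c)
    ≡⟨ solve 3 (λ x c h → x :* h :* (x :* x :- c) := x :* ((con 1ℚ :* (x :* x) :- c) :* h)) refl x c h ⟩
  x * ((1ℚ * (x * x) - c) * h)
    ≡⟨ cong (x *_) (sym (horner-mulLinear 1ℚ c (centralFactorialPoly m) (x * x))) ⟩
  x * horner (centralFactorialPoly (suc m)) (x * x) ∎
  where
  c = ι (suc m) * ι (suc m)
  h = horner (centralFactorialPoly m) (x * x)

-- pronicProduct (suc m) x is divisible by t = ½ pronic x as pronic 0 = 0; this matters because there is no p₀.
pronicProductPoly : ℕ → Poly
pronicProductPoly zero = (1ℚ + 1ℚ) ∷ []
pronicProductPoly (suc m) = mulLinear (1ℚ + 1ℚ) (pronic (ι (suc m))) (pronicProductPoly m)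

pronicProduct-horner : ∀ m x → let t = ½ * pronic x in pronicProduct (suc m) x ≡ t * horner (pronicProductPoly m) t
pronicProduct-horner zero x =
  solve 1 (λ u → con 1ℚ :* (u :- con 0ℚ) := (con ½ :* u) :* (con (1ℚ + 1ℚ) :+ (con ½ :* u) :* con 0ℚ)) refl (pronic x)
pronicProduct-horner (suc m) x = begin
  pronicProduct (suc m) x * (pronic x - u)
    ≡⟨ cong (_* (pronic x - u)) (pronicProduct-horner m x) ⟩
  t * h * (pronic x - u)
    ≡⟨ solve 3 (λ v u h → (con ½ :* v) :* h :* (v :- u) := (con ½ :* v) :* ((con (1ℚ + 1ℚ) :* (con ½ :* v) :- u) :* h))
         refl (pronic x) u h ⟩
  t * (((1ℚ + 1ℚ) * t - u) * h)
    ≡⟨ cong (t *_) (sym (horner-mulLinear (1ℚ + 1ℚ) u (pronicProductPoly m) t)) ⟩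
  t * horner (pronicProductPoly (suc m)) t ∎
  where
  t = ½ * pronic x
  u = pronic (ι (suc m))
  h = horner (pronicProductPoly m) t

chat-row : ∀ i k → chat (i , i ℕ.+ k) ≡ ½ * pronic (ι k)
chat-row i k rewrite ℕP.m+n∸m≡n i k =
  trans (m/2≡½*m (k ℕ.* suc k)) (cong (½ *_) (trans (ι-* k (suc k)) (cong (ι k *_) (ι-suc k))))

rowSum : (ℚ → ℚ) → ℕ → ℚ
rowSum g l = sumℚ (map (λ k → g (½ * pronic (ι k))) (upTo l))

sum-shiftedFrom : ∀ (g : ℚ → ℚ) i λs → sumℚ (map g (map chat (shiftedFrom i λs))) ≡ sumℚ (map (rowSum g) λs)
sum-shiftedFrom g i [] = refl
sum-shiftedFrom g i (l ∷ ls) = begin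
  sumℚ (map g (map chat (row i l ++ rest)))
    ≡⟨ cong (λ bs → sumℚ (map g bs)) (map-++ chat (row i l) rest) ⟩
  sumℚ (map g (map chat (row i l) ++ map chat rest))
    ≡⟨ cong sumℚ (map-++ g (map chat (row i l)) (map chat rest)) ⟩
  sumℚ (map g (map chat (row i l)) ++ map g (map chat rest))
    ≡⟨ sum-++ (map g (map chat (row i l))) (map g (map chat rest)) ⟩
  sumℚ (map g (map chat (row i l))) + sumℚ (map g (map chat rest))
    ≡⟨ cong₂ _+_ first-row (sum-shiftedFrom g (suc i) ls) ⟩
  rowSum g l + sumℚ (map (rowSum g) ls) ∎
  where
  rest = shiftedFrom (suc i) ls
  first-row : sumℚ (map g (map chat (row i l))) ≡ rowSum g l
  first-row = begin
    sumℚ (map g (map chat (row i l)))                  ≡⟨ sum-map-map g chat (row i l) ⟩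
    sumℚ (map (λ b → g (chat b)) (row i l))            ≡⟨ sum-map-map (λ b → g (chat b)) (λ k → i , i ℕ.+ k) (upTo l) ⟩
    sumℚ (map (λ k → g (chat (i , i ℕ.+ k))) (upTo l)) ≡⟨ sum-cong (upTo l) (λ k → cong g (chat-row i k)) ⟩
    rowSum g l                                         ∎

ι-size : ∀ λs → ι (size λs) ≡ sumℚ (map ι λs)
ι-size [] = refl
ι-size (l ∷ ls) = trans (ι-+ l (size ls)) (cong (ι l +_) (ι-size ls))

combinationSym : (ℕ → SymFn) → ℕ → List ℚ → SymFn
combinationSym g s [] = const 0ℚ
combinationSym g s (a ∷ as) = add (mul (const a) (g s)) (combinationSym g (suc s) as)

evalSym-combinationSym : ∀ g s as xs → evalSym (combinationSym g s as) xs ≡ combination (λ i → evalSym (g i) xs) s as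
evalSym-combinationSym g s [] xs = refl
evalSym-combinationSym g s (a ∷ as) xs = cong (a * evalSym (g s) xs +_) (evalSym-combinationSym g (suc s) as xs)

combinationSym-Γ : ∀ {g} → (∀ i → InΓ (g i)) → ∀ s as → InΓ (combinationSym g s as)
combinationSym-Γ g∈Γ s [] = const 0ℚ
combinationSym-Γ g∈Γ s (a ∷ as) = add (mul (const a) (g∈Γ s)) (combinationSym-Γ g∈Γ (suc s) as)

combinationGen : (ℕ → GenExpr) → ℕ → List ℚ → GenExpr
combinationGen g s [] = const 0ℚ
combinationGen g s (a ∷ as) = add (mul (const a) (g s)) (combinationGen g (suc s) as)

evalGen-combinationGen : ∀ g s as λs → evalGen (combinationGen g s as) λs ≡ combination (λ i → evalGen (g i) λs) s as
evalGen-combinationGen g s [] λs = refl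
evalGen-combinationGen g s (a ∷ as) λs = cong (a * evalGen (g s) λs +_) (evalGen-combinationGen g (suc s) as λs)

powerSumPoly : Poly → SymFn
powerSumPoly = combinationSym (λ j → p (suc j)) 0

evalSym-powerSumPoly : ∀ cs xs → evalSym (powerSumPoly cs) xs ≡ sumℚ (map (λ x → x * horner cs x) xs)
evalSym-powerSumPoly cs xs = begin
  evalSym (powerSumPoly cs) xs
    ≡⟨ evalSym-combinationSym (λ j → p (suc j)) 0 cs xs ⟩
  combination (λ j → sumℚ (map (λ x → x * x ^ℚ j) xs)) 0 cs
    ≡⟨ sym (sum-combination (λ j x → x * x ^ℚ j) xs 0 cs) ⟩
  sumℚ (map (λ x → combination (λ j → x * x ^ℚ j) 0 cs) xs)
    ≡⟨ sum-cong xs (λ x → trans (combination-*ˡ x (x ^ℚ_) 0 cs)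
                                 (cong (x *_) (trans (combination-powers x 0 cs) (*-identityˡ (horner cs x))))) ⟩
  sumℚ (map (λ x → x * horner cs x) xs) ∎

oddPowerSumPoly : Poly → SymFn
oddPowerSumPoly = combinationSym (λ j → p (suc (2 ℕ.* j))) 0

oddPowerSumPoly-Γ : ∀ cs → InΓ (oddPowerSumPoly cs)
oddPowerSumPoly-Γ = combinationSym-Γ podd 0

evalSym-oddPowerSumPoly : ∀ cs xs → evalSym (oddPowerSumPoly cs) xs ≡ sumℚ (map (λ x → x * horner cs (x * x)) xs)
evalSym-oddPowerSumPoly cs xs = begin
  evalSym (oddPowerSumPoly cs) xs
    ≡⟨ evalSym-combinationSym (λ j → p (suc (2 ℕ.* j))) 0 cs xs ⟩
  combination (λ j → sumℚ (map (λ x → x ^ℚ suc (2 ℕ.* j)) xs)) 0 cs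
    ≡⟨ sym (sum-combination (λ j x → x ^ℚ suc (2 ℕ.* j)) xs 0 cs) ⟩
  sumℚ (map (λ x → combination (λ j → x ^ℚ suc (2 ℕ.* j)) 0 cs) xs)
    ≡⟨ sum-cong xs odd ⟩
  sumℚ (map (λ x → x * horner cs (x * x)) xs) ∎
  where
  odd : ∀ x → combination (λ j → x ^ℚ suc (2 ℕ.* j)) 0 cs ≡ x * horner cs (x * x)
  odd x = begin
    combination (λ j → x ^ℚ suc (2 ℕ.* j)) 0 cs ≡⟨ combination-cong (^ℚ-odd x) 0 cs ⟩
    combination (λ j → x * (x * x) ^ℚ j) 0 cs   ≡⟨ combination-*ˡ x ((x * x) ^ℚ_) 0 cs ⟩
    x * combination (λ j → (x * x) ^ℚ j) 0 cs   ≡⟨ cong (x *_) (combination-powers (x * x) 0 cs) ⟩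
    x * (1ℚ * horner cs (x * x))                ≡⟨ cong (x *_) (*-identityˡ _) ⟩
    x * horner cs (x * x)                       ∎

centralFactorial-sum : ∀ m λs →
  sumℚ (map (λ l → centralFactorial m (ι l)) λs) ≡ evalAtPartition (oddPowerSumPoly (centralFactorialPoly m)) λs
centralFactorial-sum m λs = begin
  sumℚ (map (λ l → centralFactorial m (ι l)) λs)
    ≡⟨ sym (sum-map-map (centralFactorial m) ι λs) ⟩
  sumℚ (map (centralFactorial m) (map ι λs))
    ≡⟨ sum-cong (map ι λs) (centralFactorial-horner m) ⟩
  sumℚ (map (λ x → x * horner (centralFactorialPoly m) (x * x)) (map ι λs))
    ≡⟨ sym (evalSym-oddPowerSumPoly (centralFactorialPoly m) (map ι λs)) ⟩
  evalAtPartition (oddPowerSumPoly (centralFactorialPoly m)) λs ∎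

-- Every generator lies in Γ

pronicNodes : ℕ → ℚ
pronicNodes s = pronic (ι s)

rowSum-power : ∀ r l → rowSum (_^ℚ r) l ≡
  ½ ^ℚ r * combination (λ i → recipSuc (2 ℕ.* i) * centralFactorial i (ι l)) 0 (newtonPower pronicNodes r)
rowSum-power r l = begin
  sumℚ (map (λ k → (½ * pronic (ι k)) ^ℚ r) (upTo l))
    ≡⟨ sum-cong (upTo l) expand ⟩
  sumℚ (map (λ k → ½ ^ℚ r * combination (λ i → pronicProduct i (ι k)) 0 N) (upTo l))
    ≡⟨ sum-* (½ ^ℚ r) (λ k → combination (λ i → pronicProduct i (ι k)) 0 N) (upTo l) ⟩
  ½ ^ℚ r * sumℚ (map (λ k → combination (λ i → pronicProduct i (ι k)) 0 N) (upTo l))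
    ≡⟨ cong (½ ^ℚ r *_) (sum-combination (λ i k → pronicProduct i (ι k)) (upTo l) 0 N) ⟩
  ½ ^ℚ r * combination (λ i → sumℚ (map (λ k → pronicProduct i (ι k)) (upTo l))) 0 N
    ≡⟨ cong (½ ^ℚ r *_) (combination-cong (λ i → sum-pronicProduct i l) 0 N) ⟩
  ½ ^ℚ r * combination (λ i → recipSuc (2 ℕ.* i) * centralFactorial i (ι l)) 0 N ∎
  where
  N = newtonPower pronicNodes r
  expand : ∀ k → (½ * pronic (ι k)) ^ℚ r ≡ ½ ^ℚ r * combination (λ i → pronicProduct i (ι k)) 0 N
  expand k = trans (^ℚ-distrib-* ½ (pronic (ι k)) r) (cong (½ ^ℚ r *_) (trans (sym (*-identityʳ _))
    (newtonExpansion {λ i → pronicProduct i (ι k)} {pronicNodes} {pronic (ι k)} (λ s → refl) r)))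

hatPowerSum : ℕ → SymFn
hatPowerSum r = mul (const (½ ^ℚ r))
  (combinationSym (λ i → mul (const (recipSuc (2 ℕ.* i))) (oddPowerSumPoly (centralFactorialPoly i))) 0
                  (newtonPower pronicNodes r))

hatPowerSum-Γ : ∀ r → InΓ (hatPowerSum r)
hatPowerSum-Γ r = mul (const (½ ^ℚ r))
  (combinationSym-Γ (λ i → mul (const (recipSuc (2 ℕ.* i))) (oddPowerSumPoly-Γ (centralFactorialPoly i))) 0
                    (newtonPower pronicNodes r))

hatEval-p : ∀ r .{{_ : ℕ.NonZero r}} λs → hatEval (p r) λs ≡ evalAtPartition (hatPowerSum r) λs
hatEval-p r λs = begin
  sumℚ (map (_^ℚ r) (map chat (shiftedDiagram λs)))
    ≡⟨ sum-shiftedFrom (_^ℚ r) 1 λs ⟩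
  sumℚ (map (rowSum (_^ℚ r)) λs)
    ≡⟨ sum-cong λs (rowSum-power r) ⟩
  sumℚ (map (λ l → ½ ^ℚ r * combination (λ i → f i l) 0 N) λs)
    ≡⟨ sum-* (½ ^ℚ r) (λ l → combination (λ i → f i l) 0 N) λs ⟩
  ½ ^ℚ r * sumℚ (map (λ l → combination (λ i → f i l) 0 N) λs)
    ≡⟨ cong (½ ^ℚ r *_) (sum-combination f λs 0 N) ⟩
  ½ ^ℚ r * combination (λ i → sumℚ (map (f i) λs)) 0 N
    ≡⟨ cong (½ ^ℚ r *_) (combination-cong summand 0 N) ⟩
  ½ ^ℚ r * combination (λ i → recipSuc (2 ℕ.* i) * evalAtPartition (oddPowerSumPoly (centralFactorialPoly i)) λs) 0 N
    ≡⟨ cong (½ ^ℚ r *_) (sym (evalSym-combinationSym _ 0 N (map ι λs))) ⟩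
  evalAtPartition (hatPowerSum r) λs ∎
  where
  N = newtonPower pronicNodes r
  f = λ i l → recipSuc (2 ℕ.* i) * centralFactorial i (ι l)
  summand : ∀ i → sumℚ (map (f i) λs) ≡ recipSuc (2 ℕ.* i) * evalAtPartition (oddPowerSumPoly (centralFactorialPoly i)) λs
  summand i = trans (sum-* (recipSuc (2 ℕ.* i)) (λ l → centralFactorial i (ι l)) λs)
                    (cong (recipSuc (2 ℕ.* i) *_) (centralFactorial-sum i λs))

hatToΓ : SymFn → SymFn
hatToΓ (const q) = const q
hatToΓ (p r) = hatPowerSum r
hatToΓ (add F G) = add (hatToΓ F) (hatToΓ G)
hatToΓ (mul F G) = mul (hatToΓ F) (hatToΓ G)

hatToΓ-Γ : ∀ F → InΓ (hatToΓ F)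
hatToΓ-Γ (const q) = const q
hatToΓ-Γ (p r) = hatPowerSum-Γ r
hatToΓ-Γ (add F G) = add (hatToΓ-Γ F) (hatToΓ-Γ G)
hatToΓ-Γ (mul F G) = mul (hatToΓ-Γ F) (hatToΓ-Γ G)

hatEval-hatToΓ : ∀ F λs → hatEval F λs ≡ evalAtPartition (hatToΓ F) λs
hatEval-hatToΓ (const q) λs = refl
hatEval-hatToΓ (p r ⦃ _ ⦄) λs = hatEval-p r λs
hatEval-hatToΓ (add F G) λs = cong₂ _+_ (hatEval-hatToΓ F λs) (hatEval-hatToΓ G λs)
hatEval-hatToΓ (mul F G) λs = cong₂ _*_ (hatEval-hatToΓ F λs) (hatEval-hatToΓ G λs)

genToΓ : GenExpr → SymFn
genToΓ (const q) = const q
genToΓ sizeG = p 1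
genToΓ (hat F) = hatToΓ F
genToΓ (add e e') = add (genToΓ e) (genToΓ e')
genToΓ (mul e e') = mul (genToΓ e) (genToΓ e')

genToΓ-Γ : ∀ e → InΓ (genToΓ e)
genToΓ-Γ (const q) = const q
genToΓ-Γ sizeG = podd 0
genToΓ-Γ (hat F) = hatToΓ-Γ F
genToΓ-Γ (add e e') = add (genToΓ-Γ e) (genToΓ-Γ e')
genToΓ-Γ (mul e e') = mul (genToΓ-Γ e) (genToΓ-Γ e')

evalGen-genToΓ : ∀ e λs → evalGen e λs ≡ evalAtPartition (genToΓ e) λs
evalGen-genToΓ (const q) λs = refl
evalGen-genToΓ sizeG λs =
  trans (ι-size λs) (trans (sum-cong λs (λ l → sym (*-identityʳ (ι l)))) (sym (sum-map-map (_^ℚ 1) ι λs)))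
evalGen-genToΓ (hat F) λs = hatEval-hatToΓ F λs
evalGen-genToΓ (add e e') λs = cong₂ _+_ (evalGen-genToΓ e λs) (evalGen-genToΓ e' λs)
evalGen-genToΓ (mul e e') λs = cong₂ _*_ (evalGen-genToΓ e λs) (evalGen-genToΓ e' λs)

-- Every element of Γ is generated

centralFactorialSumGen : ℕ → GenExpr
centralFactorialSumGen zero = sizeG
centralFactorialSumGen (suc m) =
  mul (const (ι (suc (2 ℕ.* suc m)))) (hat (powerSumPoly (pronicProductPoly m)))

evalGen-centralFactorialSumGen : ∀ m λs →
  evalGen (centralFactorialSumGen m) λs ≡ sumℚ (map (λ l → centralFactorial m (ι l)) λs)
evalGen-centralFactorialSumGen zero λs = ι-size λs
evalGen-centralFactorialSumGen (suc m) λs = begin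
  c * evalSym (powerSumPoly (pronicProductPoly m)) (map chat (shiftedDiagram λs))
    ≡⟨ cong (c *_) (evalSym-powerSumPoly (pronicProductPoly m) (map chat (shiftedDiagram λs))) ⟩
  c * sumℚ (map g (map chat (shiftedDiagram λs)))
    ≡⟨ cong (c *_) (sum-shiftedFrom g 1 λs) ⟩
  c * sumℚ (map (rowSum g) λs)
    ≡⟨ cong (c *_) (sum-cong λs row-sum) ⟩
  c * sumℚ (map (λ l → d * centralFactorial (suc m) (ι l)) λs)
    ≡⟨ cong (c *_) (sum-* d (λ l → centralFactorial (suc m) (ι l)) λs) ⟩
  c * (d * S)
    ≡⟨ solve 3 (λ c d s → c :* (d :* s) := (d :* c) :* s) refl c d S ⟩
  (d * c) * S
    ≡⟨ cong (_* S) (recipSuc-inverse (2 ℕ.* suc m)) ⟩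
  1ℚ * S
    ≡⟨ *-identityˡ S ⟩
  S ∎
  where
  c = ι (suc (2 ℕ.* suc m))
  d = recipSuc (2 ℕ.* suc m)
  g = λ x → x * horner (pronicProductPoly m) x
  S = sumℚ (map (λ l → centralFactorial (suc m) (ι l)) λs)
  row-sum : ∀ l → rowSum g l ≡ d * centralFactorial (suc m) (ι l)
  row-sum l = trans (sum-cong (upTo l) (λ k → sym (pronicProduct-horner m (ι k)))) (sum-pronicProduct (suc m) l)

squareNodes : ℕ → ℚ
squareNodes s = ι (suc s) * ι (suc s)

ΓtoGen : ∀ {f} → InΓ f → GenExpr
ΓtoGen (const q) = const q
ΓtoGen (podd k) = combinationGen centralFactorialSumGen 0 (newtonPower squareNodes k)
ΓtoGen (add a b) = add (ΓtoGen a) (ΓtoGen b)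
ΓtoGen (mul a b) = mul (ΓtoGen a) (ΓtoGen b)

evalGen-ΓtoGen : ∀ {f} (f∈Γ : InΓ f) λs → evalGen (ΓtoGen f∈Γ) λs ≡ evalAtPartition f λs
evalGen-ΓtoGen (const q) λs = refl
evalGen-ΓtoGen (podd k) λs = begin
  evalGen (combinationGen centralFactorialSumGen 0 N) λs
    ≡⟨ evalGen-combinationGen centralFactorialSumGen 0 N λs ⟩
  combination (λ i → evalGen (centralFactorialSumGen i) λs) 0 N
    ≡⟨ combination-cong (λ i → evalGen-centralFactorialSumGen i λs) 0 N ⟩
  combination (λ i → sumℚ (map (λ l → centralFactorial i (ι l)) λs)) 0 N
    ≡⟨ sym (sum-combination (λ i l → centralFactorial i (ι l)) λs 0 N) ⟩
  sumℚ (map (λ l → combination (λ i → centralFactorial i (ι l)) 0 N) λs)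
    ≡⟨ sum-cong λs odd-power ⟩
  sumℚ (map (λ l → ι l ^ℚ suc (2 ℕ.* k)) λs)
    ≡⟨ sym (sum-map-map (_^ℚ suc (2 ℕ.* k)) ι λs) ⟩
  evalAtPartition (p (suc (2 ℕ.* k))) λs ∎
  where
  N = newtonPower squareNodes k
  odd-power : ∀ l → combination (λ i → centralFactorial i (ι l)) 0 N ≡ ι l ^ℚ suc (2 ℕ.* k)
  odd-power l = begin
    combination (λ i → centralFactorial i (ι l)) 0 N
      ≡⟨ sym (newtonExpansion {λ i → centralFactorial i (ι l)} {squareNodes} {ι l * ι l} (λ s → refl) k) ⟩
    (ι l * ι l) ^ℚ k * ι l ≡⟨ *-comm ((ι l * ι l) ^ℚ k) (ι l) ⟩
    ι l * (ι l * ι l) ^ℚ k ≡⟨ sym (^ℚ-odd (ι l) k) ⟩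
    ι l ^ℚ suc (2 ℕ.* k)   ∎
evalGen-ΓtoGen (add a b) λs = cong₂ _+_ (evalGen-ΓtoGen a λs) (evalGen-ΓtoGen b λs)
evalGen-ΓtoGen (mul a b) λs = cong₂ _*_ (evalGen-ΓtoGen a λs) (evalGen-ΓtoGen b λs)

proposition5p4 :
    ((f : SymFn) → InΓ f →
       Σ GenExpr (λ e → (λs : List ℕ) → IsStrictPartition λs →
         evalGen e λs ≡ evalAtPartition f λs))
    ×
    ((e : GenExpr) →
       Σ SymFn (λ f → InΓ f × ((λs : List ℕ) → IsStrictPartition λs →
         evalGen e λs ≡ evalAtPartition f λs)))
proposition5p4 =
  (λ f f∈Γ → ΓtoGen f∈Γ , λ λs _ → evalGen-ΓtoGen f∈Γ λs) ,
  (λ e → genToΓ e , genToΓ-Γ e , λ λs _ → evalGen-genToΓ e λs)
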